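{- Let $S\subseteq\mathbb N^d$ be a good semigroup, $E\subseteq S$ a good ideal and $\alpha\in E$. Suppose there exists $\beta\in\Delta^E_F(\alpha)$ for some $F\subsetneq I$. Then there exist $r$ with $1\le r\le|F|$, elements $\beta^{(1)},\dots,\beta^{(r)}\in E$ and sets $G_1,\dots,G_r$ such that $\beta^{(i)}\in\Delta^E_{G_i}(\alpha)$, $G_i\supseteq\widehat F$ for each $i$, $G_1\cap\cdots\cap G_r=\widehat F$, and $\alpha$ is a complete infimum of $\beta,\beta^{(1)},\dots,\beta^{(r)}$ (in $E$).
   Context: $I=\{1,\dots,d\}$, $\le$ componentwise order on $\mathbb N^d$, $\wedge$ componentwise minimum, $\widehat F=I\setminus F$. A good semigroup is a submonoid $S$ of $(\mathbb N^d,+)$ with (G1) $\alpha\wedge\beta\in S$ for $\alpha,\beta\in S$; (G2) if $\alpha,\beta\in S$, $\alpha\ne\beta$, $\alpha_i=\beta_i$, there is $\epsilon\in S$ with $\epsilon_i>\alpha_i$, $\epsilon_j\ge\min(\alpha_j,\beta_j)$ for $j\ne i$, with equality when $\alpha_j\ne\beta_j$; (G3) some $c\in S$ has $c+\mathbb N^d\subseteq S$. A good ideal is $E\subseteq S$ with $E+S\subseteq E$ satisfying (G1),(G2) inside $E$. $\Delta^X_F(\alpha)=\{\beta\in X:\beta_i=\alpha_i\ (i\in F),\ \beta_j>\alpha_j\ (j\notin F)\}$. For $Y\subseteq S$ and $\alpha\in Y$, $\alpha$ is a complete infimum in $Y$ of $\gamma^{(1)},\dots,\gamma^{(m)}\in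 Y$ ($m\ge2$) if there are nonempty sets $F_1,\dots,F_m\subsetneq I$ with $\gamma^{(j)}\in\Delta^S_{F_j}(\alpha)$, $\gamma^{(j)}\wedge\gamma^{(k)}=\alpha$ for all $j\ne k$, and $F_1\cap\cdots\cap F_m=\emptyset$. -}

module Defs where

open import Data.Nat using (ℕ; zero; suc; _+_; _≤_; _<_; _⊓_)
open import Data.Fin using (Fin)
open import Data.Fin.Subset using (Subset; _∈_; _∉_; _⊂_; ⊤; ∁; Nonempty)
open import Data.Product using (Σ; ∃; _×_; _,_)
open import Relation.Binary.PropositionalEquality using (_≡_; _≢_)
open import Relation.Nullary using (¬_)

-- Points of ℕ^d, with I = Fin d.
Pt : ℕ → Set
Pt d = Fin d → ℕ

PSet : ℕ → Set₁
PSet d = Pt d → Set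

_⊕_ : ∀ {d} → Pt d → Pt d → Pt d
(α ⊕ β) k = α k + β k

_∧_ : ∀ {d} → Pt d → Pt d → Pt d
(α ∧ β) k = α k ⊓ β k

𝟎 : ∀ {d} → Pt d
𝟎 k = 0

_≐_ : ∀ {d} → Pt d → Pt d → Set
α ≐ β = ∀ k → α k ≡ β k

G1 : ∀ {d} → PSet d → Set
G1 X = ∀ α β → X α → X β → X (α ∧ β)

G2 : ∀ {d} → PSet d → Set
G2 {d} X = ∀ α β (i : Fin d) → X α → X β → ¬ (α ≐ β) → α i ≡ β i →
  Σ (Pt d) λ ε → X ε × (α i < ε i) ×
    (∀ j → j ≢ i → ((α j ⊓ β j) ≤ ε j) × (α j ≢ β j → ε j ≡ α j ⊓ β j))

G3 : ∀ {d} → PSet d → Set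
G3 {d} S = Σ (Pt d) λ c → S c × (∀ v → S (c ⊕ v))

record GoodSemigroup {d : ℕ} (S : PSet d) : Set where
  field
    zero∈ : S 𝟎
    +-closed : ∀ α β → S α → S β → S (α ⊕ β)
    g1 : G1 S
    g2 : G2 S
    g3 : G3 S

record GoodIdeal {d : ℕ} (S E : PSet d) : Set where
  field
    ⊆S : ∀ α → E α → S α
    ideal : ∀ α σ → E α → S σ → E (α ⊕ σ)
    g1 : G1 E
    g2 : G2 E

Δ : ∀ {d} → PSet d → Subset d → Pt d → Pt d → Set
Δ X F α β = X β × (∀ i → i ∈ F → β i ≡ α i) × (∀ j → j ∉ F → α j < β j)

CompleteInfimum : ∀ {d} (S Y : PSet d) (α : Pt d) (m : ℕ) (γ : Fin m → Pt d) → Set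
CompleteInfimum {d} S Y α m γ =
  Y α × (2 ≤ m) × (∀ j → Y (γ j)) ×
  Σ (Fin m → Subset d) λ Fs →
    (∀ j → Nonempty (Fs j)) × (∀ j → Fs j ⊂ ⊤) ×
    (∀ j → Δ S (Fs j) α (γ j)) ×
    (∀ j k → j ≢ k → (γ j ∧ γ k) ≐ α) ×
    (∀ x → ¬ (∀ j → x ∈ Fs j))

-- Starting from the family {β}, repeatedly pick a coordinate i ∈ F at which every member of the
-- family still equals α. Axiom (G2), applied to α and each member γ at i, gives an element of E
-- that exceeds α at i and equals α wherever γ exceeds α; by (G1) the meet δ of these elements
-- has the same properties with respect to the whole family. Adding δ keeps the "supports"
-- {j : γ j > α j} of the members pairwise disjoint and strictly shrinks the set of coordinates of
-- F at which all members equal α, so at most ∣F∣ steps are needed. When that set is empty, the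
-- agreement sets {j : γ j = α j} of the members have empty intersection, and disjointness of the
-- supports says exactly that the pairwise meets are α: α is their complete infimum.
module Submission where

open import Defs
open import Data.Nat using (ℕ; zero; suc; _≤_; _<_; _+_; _⊓_; s≤s; z≤n)
open import Data.Nat.Properties
open import Data.Fin using (Fin; punchIn) renaming (zero to fzero; suc to fsuc)
open import Data.Fin.Properties using (punchInᵢ≢i) renaming (_≟_ to _≟ᶠ_)
open import Data.Fin.Subset using (Subset; _∈_; _∉_; _⊂_; ⊤; ∁; ∣_∣; Nonempty; Empty; _∩_)
open import Data.Fin.Subset.Properties
  using (_∈?_; nonempty?; ∈⊤; p⊂q⇒∣p∣<∣q∣; x∈∁p⇒x∉p; x∉p⇒x∈∁p; x∈p∩q⁺; x∈p∩q⁻; p∩q⊆p)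
open import Data.Product using (Σ; ∃; _×_; _,_; proj₁; proj₂)
open import Data.Sum using (_⊎_; inj₁; inj₂; swap)
open import Data.Bool using (true)
open import Data.Vec using (tabulate)
open import Data.Vec.Functional using (_∷_)
open import Data.Vec.Properties using (lookup∘tabulate; []=⇒lookup; lookup⇒[]=)
open import Function using (_∘_)
open import Function.Bundles using (_⇔_; mk⇔)
open import Relation.Binary.Definitions using (Symmetric)
open import Relation.Binary.PropositionalEquality using (_≡_; _≢_; refl; sym; trans; cong)
open import Relation.Nullary using (¬_; Dec; yes; no; does; contradiction)
open import Relation.Nullary.Decidable using (dec-true; decidable-stable)

_≤ᵖ_ : ∀ {d} → Pt d → Pt d → Set
u ≤ᵖ v = ∀ j → u j ≤ v j

all-∷ : ∀ {A : Set} {P : A → Set} {m x} {f : Fin m → A} →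
        P x → (∀ k → P (f k)) → ∀ k → P ((x ∷ f) k)
all-∷ px pf fzero    = px
all-∷ px pf (fsuc k) = pf k

Pairwise : ∀ {A : Set} {m} → (A → A → Set) → (Fin m → A) → Set
Pairwise R f = ∀ k l → k ≢ l → R (f k) (f l)

pairwise-∷ : ∀ {A : Set} {R : A → A → Set} {m x} {f : Fin m → A} →
             Symmetric R → (∀ k → R x (f k)) → Pairwise R f → Pairwise R (x ∷ f)
pairwise-∷ R-sym x-f f-f fzero    fzero    k≢l = contradiction refl k≢l
pairwise-∷ R-sym x-f f-f fzero    (fsuc l) _   = x-f l
pairwise-∷ R-sym x-f f-f (fsuc k) fzero    _   = R-sym (x-f k)
pairwise-∷ R-sym x-f f-f (fsuc k) (fsuc l) k≢l = f-f k l (k≢l ∘ cong fsuc)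

⋀ : ∀ {d m} → (Fin (suc m) → Pt d) → Pt d
⋀ {m = zero}  γ = γ fzero
⋀ {m = suc m} γ = γ fzero ∧ ⋀ (γ ∘ fsuc)

⋀-closed : ∀ {d m} {X : PSet d} → G1 X → (γ : Fin (suc m) → Pt d) → (∀ k → X (γ k)) → X (⋀ γ)
⋀-closed {m = zero}  g1 γ Xγ = Xγ fzero
⋀-closed {m = suc m} g1 γ Xγ = g1 _ _ (Xγ fzero) (⋀-closed g1 (γ ∘ fsuc) (Xγ ∘ fsuc))

⋀-lower : ∀ {d m} (γ : Fin (suc m) → Pt d) k → ⋀ γ ≤ᵖ γ k
⋀-lower {m = zero}  γ fzero    j = ≤-refl
⋀-lower {m = suc m} γ fzero    j = m⊓n≤m _ _
⋀-lower {m = suc m} γ (fsuc k) j = ≤-trans (m⊓n≤n _ _) (⋀-lower (γ ∘ fsuc) k j)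

⋀-greatest : ∀ {d m} (γ : Fin (suc m) → Pt d) j {n} → (∀ k → n ≤ γ k j) → n ≤ ⋀ γ j
⋀-greatest {m = zero}  γ j n≤γ = n≤γ fzero
⋀-greatest {m = suc m} γ j n≤γ = ⊓-glb (n≤γ fzero) (⋀-greatest (γ ∘ fsuc) j (n≤γ ∘ fsuc))

module RelativeTo {d : ℕ} (α : Pt d) where

  Disjoint : Pt d → Pt d → Set
  Disjoint u v = ∀ j → u j ≡ α j ⊎ v j ≡ α j

  disjoint-sym : Symmetric Disjoint
  disjoint-sym u-v = swap ∘ u-v

  disjoint-mono : ∀ {u v w} → α ≤ᵖ w → w ≤ᵖ v → Disjoint u v → Disjoint u w
  disjoint-mono α≤w w≤v u-v j with u-v j
  ... | inj₁ u≡α = inj₁ u≡α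
  ... | inj₂ v≡α = inj₂ (≤-antisym (≤-trans (w≤v j) (≤-reflexive v≡α)) (α≤w j))

  disjoint⇒∧≐α : ∀ {u v} → α ≤ᵖ u → α ≤ᵖ v → Disjoint u v → (u ∧ v) ≐ α
  disjoint⇒∧≐α {u} {v} α≤u α≤v u-v j = ≤-antisym (∧≤α (u-v j)) (⊓-glb (α≤u j) (α≤v j))
    where
      ∧≤α : u j ≡ α j ⊎ v j ≡ α j → u j ⊓ v j ≤ α j
      ∧≤α (inj₁ u≡α) = ≤-trans (m⊓n≤m _ _) (≤-reflexive u≡α)
      ∧≤α (inj₂ v≡α) = ≤-trans (m⊓n≤n _ _) (≤-reflexive v≡α)

  abstract
    Agree : Pt d → Subset d
    Agree γ = tabulate λ j → does (γ j ≟ α j)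

    ∈-Agree⁺ : ∀ {γ x} → γ x ≡ α x → x ∈ Agree γ
    ∈-Agree⁺ {γ} {x} γ≡α =
      lookup⇒[]= x (Agree γ) (trans (lookup∘tabulate _ x) (dec-true (γ x ≟ α x) γ≡α))

    ∈-Agree⁻ : ∀ {γ x} → x ∈ Agree γ → γ x ≡ α x
    ∈-Agree⁻ {γ} {x} x∈ = reflect (γ x ≟ α x) (trans (sym ([]=⇒lookup x∈)) (lookup∘tabulate _ x))
      where
        reflect : (γ≟α : Dec (γ x ≡ α x)) → true ≡ does γ≟α → γ x ≡ α x
        reflect (yes γ≡α) _ = γ≡α
        reflect (no _)    ()

  Δ-Agree : ∀ {Y : PSet d} {γ} → Y γ → α ≤ᵖ γ → Δ Y (Agree γ) α γ
  Δ-Agree Yγ α≤γ =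
    Yγ , (λ x → ∈-Agree⁻) , λ x x∉ → ≤∧≢⇒< (α≤γ x) (x∉ ∘ ∈-Agree⁺ ∘ sym)

  Agree⊂⊤ : ∀ {γ} → (∃ λ w → γ w ≢ α w) → Agree γ ⊂ ⊤
  Agree⊂⊤ (w , γ≢α) = (λ _ → ∈⊤) , w , ∈⊤ , γ≢α ∘ ∈-Agree⁻

  Agree-nonempty : ∀ {m} {γ : Fin m → Pt d} → 2 ≤ m → Pairwise Disjoint γ →
                   (∀ k → ∃ λ w → γ k w ≢ α w) → ∀ k → Nonempty (Agree (γ k))
  Agree-nonempty (s≤s (s≤s z≤n)) separated moves k with moves (punchIn k fzero)
  ... | w , γ'≢α with separated k (punchIn k fzero) (punchInᵢ≢i k fzero ∘ sym) w
  ...   | inj₁ γ≡α  = w , ∈-Agree⁺ γ≡α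
  ...   | inj₂ γ'≡α = contradiction γ'≡α γ'≢α

  module Within (X : PSet d) (Xα : X α) where

    record Above (γ : Pt d) : Set where
      field
        ∈X    : X γ
        ≥α    : α ≤ᵖ γ
        moves : ∃ λ w → γ w ≢ α w

    open Above

    record RaisedAt (i : Fin d) (ε : Pt d) : Set where
      field
        ∈X   : X ε
        ≥α   : α ≤ᵖ ε
        >α   : α i < ε i

    raise : G2 X → ∀ {γ} i → Above γ → γ i ≡ α i → ∃ λ ε → RaisedAt i ε × Disjoint γ ε
    raise g2 {γ} i γ↑ γi≡αi
      with g2 α γ i Xα (∈X γ↑) (λ α≐γ → proj₂ (moves γ↑) (sym (α≐γ _))) (sym γi≡αi)
    ... | ε , Xε , αi<εi , off-i =
      ε , record { ∈X = Xε ; ≥α = proj₁ ∘ at ; >α = αi<εi } , proj₂ ∘ at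
      where
        α⊓γ≡α : ∀ j → α j ⊓ γ j ≡ α j
        α⊓γ≡α j = m≤n⇒m⊓n≡m (≥α γ↑ j)

        lower : ∀ j → j ≢ i → α j ≤ ε j
        lower j j≢i = ≤-trans (≤-reflexive (sym (α⊓γ≡α j))) (proj₁ (off-i j j≢i))

        at : ∀ j → α j ≤ ε j × (γ j ≡ α j ⊎ ε j ≡ α j)
        at j with j ≟ᶠ i | γ j ≟ α j
        ... | yes refl | _       = <⇒≤ αi<εi , inj₁ γi≡αi
        ... | no j≢i   | yes γ≡α = lower j j≢i , inj₁ γ≡α
        ... | no j≢i   | no γ≢α  =
          lower j j≢i , inj₂ (trans (proj₂ (off-i j j≢i) (γ≢α ∘ sym)) (α⊓γ≡α j))

    raise-family : G1 X → G2 X → ∀ {m} (γ : Fin (suc m) → Pt d) i →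
                   (∀ k → Above (γ k)) → (∀ k → γ k i ≡ α i) →
                   ∃ λ δ → RaisedAt i δ × ∀ k → Disjoint (γ k) δ
    raise-family g1 g2 γ i γ↑ γi≡αi =
      ⋀ ε , record { ∈X = ⋀-closed g1 ε (RaisedAt.∈X ∘ ε↑) ; ≥α = α≤⋀ε
                   ; >α = ⋀-greatest ε i (RaisedAt.>α ∘ ε↑) }
          , λ k → disjoint-mono α≤⋀ε (⋀-lower ε k) (γ-ε k)
      where
        ε : Fin _ → Pt d
        ε k = proj₁ (raise g2 i (γ↑ k) (γi≡αi k))
        ε↑ : ∀ k → RaisedAt i (ε k)
        ε↑ k = proj₁ (proj₂ (raise g2 i (γ↑ k) (γi≡αi k)))
        γ-ε : ∀ k → Disjoint (γ k) (ε k)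
        γ-ε k = proj₂ (proj₂ (raise g2 i (γ↑ k) (γi≡αi k)))
        α≤⋀ε : α ≤ᵖ ⋀ ε
        α≤⋀ε j = ⋀-greatest ε j λ k → RaisedAt.≥α (ε↑ k) j

    complete-infimum : ∀ {S : PSet d} → (∀ γ → X γ → S γ) → ∀ {m} (γ : Fin m → Pt d) → 2 ≤ m →
                       (∀ k → Above (γ k)) → Pairwise Disjoint γ →
                       (∀ x → ¬ (∀ k → x ∈ Agree (γ k))) → CompleteInfimum S X α m γ
    complete-infimum {S} X⊆S γ 2≤m γ↑ separated no-common =
      Xα , 2≤m , (λ k → ∈X (γ↑ k)) , Agree ∘ γ
         , Agree-nonempty 2≤m separated (λ k → moves (γ↑ k))
         , (λ k → Agree⊂⊤ (moves (γ↑ k)))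
         , (λ k → Δ-Agree {Y = S} (X⊆S _ (∈X (γ↑ k))) (≥α (γ↑ k)))
         , (λ k l k≢l → disjoint⇒∧≐α (≥α (γ↑ k)) (≥α (γ↑ l)) (separated k l k≢l))
         , no-common

module Construction {d : ℕ} (S E : PSet d) (GE : GoodIdeal S E)
  (α : Pt d) (Eα : E α) (F : Subset d) (F⊂⊤ : F ⊂ ⊤) (β : Pt d) (Δβ : Δ E F α β) where

  open GoodIdeal GE
  open RelativeTo α
  open Within E Eα

  β≡α : ∀ {x} → x ∈ F → β x ≡ α x
  β≡α = proj₁ (proj₂ Δβ) _

  β≢α : ∀ {x} → x ∉ F → β x ≢ α x
  β≢α x∉F β≡α = <⇒≢ (proj₂ (proj₂ Δβ) _ x∉F) (sym β≡α)

  β≡α⇒∈F : ∀ {x} → β x ≡ α x → x ∈ F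
  β≡α⇒∈F {x} β≡α = decidable-stable (x ∈? F) λ x∉F → β≢α x∉F β≡α

  β↑ : Above β
  β↑ = record
    { ∈X    = proj₁ Δβ
    ; ≥α    = λ x → [ x ∈? F ]
    ; moves = proj₁ (proj₂ F⊂⊤) , β≢α (proj₂ (proj₂ (proj₂ F⊂⊤)))
    }
    where
      [_] : ∀ {x} → Dec (x ∈ F) → α x ≤ β x
      [ yes x∈F ] = ≤-reflexive (sym (β≡α x∈F))
      [ no x∉F ]  = <⇒≤ (proj₂ (proj₂ Δβ) _ x∉F)

  record Stage : Set where
    field
      r         : ℕ
      bs        : Fin r → Pt d
      above     : ∀ k → Above (bs k)
      separated : Pairwise Disjoint bs
      apart     : ∀ k → Disjoint β (bs k)
      J         : Subset d
      J⁺        : ∀ {x} → x ∈ F → (∀ k → bs k x ≡ α x) → x ∈ J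
      J⁻        : ∀ {x} → x ∈ J → x ∈ F × (∀ k → bs k x ≡ α x)
      size      : r + ∣ J ∣ ≤ ∣ F ∣

  open Stage

  initial : Stage
  initial = record
    { r = 0 ; bs = λ () ; above = λ () ; separated = λ () ; apart = λ ()
    ; J = F ; J⁺ = λ x∈F _ → x∈F ; J⁻ = λ x∈F → x∈F , λ () ; size = ≤-refl }

  step : (st : Stage) → ∀ {i} → i ∈ J st → Σ Stage λ st' → ∣ J st' ∣ < ∣ J st ∣
  step st {i} i∈J = st' , ∣J'∣<∣J∣
    where
      family-above : ∀ k → Above ((β ∷ bs st) k)
      family-above = all-∷ {P = Above} β↑ (above st)

      family-at-i : ∀ k → (β ∷ bs st) k i ≡ α i
      family-at-i = all-∷ {P = λ (γ : Pt d) → γ i ≡ α i} (β≡α (proj₁ (J⁻ st i∈J))) (proj₂ (J⁻ st i∈J))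

      raised : ∃ λ δ → RaisedAt i δ × ∀ k → Disjoint ((β ∷ bs st) k) δ
      raised = raise-family g1 g2 (β ∷ bs st) i family-above family-at-i

      δ : Pt d
      δ = proj₁ raised

      δ↑ : RaisedAt i δ
      δ↑ = proj₁ (proj₂ raised)

      δ-apart : ∀ k → Disjoint ((β ∷ bs st) k) δ
      δ-apart = proj₂ (proj₂ raised)

      δi≢αi : δ i ≢ α i
      δi≢αi = <⇒≢ (RaisedAt.>α δ↑) ∘ sym

      δ-above : Above δ
      δ-above = record { ∈X = RaisedAt.∈X δ↑ ; ≥α = RaisedAt.≥α δ↑ ; moves = i , δi≢αi }

      J' : Subset d
      J' = J st ∩ Agree δ

      ∣J'∣<∣J∣ : ∣ J' ∣ < ∣ J st ∣
      ∣J'∣<∣J∣ = p⊂q⇒∣p∣<∣q∣ (p∩q⊆p _ _ , i , i∈J , δi≢αi ∘ ∈-Agree⁻ ∘ proj₂ ∘ x∈p∩q⁻ _ _)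

      J'⁻ : ∀ {x} → x ∈ J' → x ∈ F × (∀ k → (δ ∷ bs st) k x ≡ α x)
      J'⁻ {x} x∈J' with x∈p∩q⁻ _ _ x∈J'
      ... | x∈J , x∈Aδ =
        proj₁ (J⁻ st x∈J) , all-∷ {P = λ (γ : Pt d) → γ x ≡ α x} (∈-Agree⁻ x∈Aδ) (proj₂ (J⁻ st x∈J))

      st' : Stage
      st' = record
        { r         = suc (r st)
        ; bs        = δ ∷ bs st
        ; above     = all-∷ {P = Above} δ-above (above st)
        ; separated = pairwise-∷ {R = Disjoint} disjoint-sym
                        (λ k → disjoint-sym (δ-apart (fsuc k))) (separated st)
        ; apart     = all-∷ {P = Disjoint β} (δ-apart fzero) (apart st)
        ; J         = J'
        ; J⁺        = λ x∈F all≡α → x∈p∩q⁺ (J⁺ st x∈F (all≡α ∘ fsuc) , ∈-Agree⁺ (all≡α fzero))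
        ; J⁻        = J'⁻
        ; size      = ≤-trans (≤-reflexive (sym (+-suc (r st) _)))
                              (≤-trans (+-monoʳ-≤ (r st) ∣J'∣<∣J∣) (size st))
        }

  exhaust : ∀ n (st : Stage) → ∣ J st ∣ ≤ n → Σ Stage (Empty ∘ J)
  exhaust n st ∣J∣≤n with nonempty? (J st)
  ... | no J-empty = st , J-empty
  exhaust zero    st ∣J∣≤n | yes (i , i∈J) = contradiction (≤-trans (proj₂ (step st i∈J)) ∣J∣≤n) n≮0
  exhaust (suc n) st ∣J∣≤n | yes (i , i∈J) =
    exhaust n (proj₁ (step st i∈J)) (≤-pred (≤-trans (proj₂ (step st i∈J)) ∣J∣≤n))

  final : Σ Stage (Empty ∘ J)
  final = exhaust ∣ F ∣ initial (≤-trans (m≤n+m _ _) (size initial))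

  module _ (st : Stage) (J-empty : Empty (J st)) where

    r-positive : Nonempty F → 1 ≤ r st
    r-positive (x , x∈F) with r st | bs st | J⁺ st {x}
    ... | zero  | _ | x∈J = contradiction (x , x∈J x∈F λ ()) J-empty
    ... | suc r | _ | _   = s≤s z≤n

    ∁F⊆Agree : ∀ k {x} → x ∈ ∁ F → x ∈ Agree (bs st k)
    ∁F⊆Agree k {x} x∈∁F with apart st k x
    ... | inj₁ β≡α  = contradiction β≡α (β≢α (x∈∁p⇒x∉p x∈∁F))
    ... | inj₂ bs≡α = ∈-Agree⁺ bs≡α

    ⋂Agree⇔∁F : ∀ x → (∀ k → x ∈ Agree (bs st k)) ⇔ x ∈ ∁ F
    ⋂Agree⇔∁F x = mk⇔
      (λ x∈⋂ → x∉p⇒x∈∁p λ x∈F → J-empty (x , J⁺ st x∈F (∈-Agree⁻ ∘ x∈⋂)))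
      (λ x∈∁F k → ∁F⊆Agree k x∈∁F)

    no-common-agreement : ∀ x → ¬ (∀ k → x ∈ Agree ((β ∷ bs st) k))
    no-common-agreement x x∈⋂ =
      J-empty (x , J⁺ st (β≡α⇒∈F (∈-Agree⁻ (x∈⋂ fzero))) (λ k → ∈-Agree⁻ (x∈⋂ (fsuc k))))

    family-separated : Pairwise Disjoint (β ∷ bs st)
    family-separated = pairwise-∷ {R = Disjoint} disjoint-sym (apart st) (separated st)

proposition1p7 : ∀ {d : ℕ} (S E : PSet d) → GoodSemigroup S → GoodIdeal S E →
    (α : Pt d) → E α → (F : Subset d) → F ⊂ ⊤ → Nonempty F →
    (β : Pt d) → Δ E F α β →
    Σ ℕ λ r → (1 ≤ r) × (r ≤ ∣ F ∣) ×
      Σ (Fin r → Pt d) λ βs → Σ (Fin r → Subset d) λ G →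
        (∀ i → Δ E (G i) α (βs i)) ×
        (∀ i x → x ∈ ∁ F → x ∈ G i) ×
        (∀ x → ((∀ i → x ∈ G i) ⇔ x ∈ ∁ F)) ×
        CompleteInfimum S E α (suc r) (β ∷ βs)
proposition1p7 S E _ GE α Eα F F⊂⊤ F-nonempty β Δβ =
  r st , 1≤r , ≤-trans (m≤m+n _ _) (size st) , bs st , Agree ∘ bs st
    , (λ k → Δ-Agree {Y = E} (∈X (above st k)) (≥α (above st k)))
    , (λ k x → ∁F⊆Agree st J-empty k)
    , ⋂Agree⇔∁F st J-empty
    , complete-infimum (GoodIdeal.⊆S GE) (β ∷ bs st) (s≤s 1≤r)
        (all-∷ {P = Above} β↑ (above st)) (family-separated st J-empty) (no-common-agreement st J-empty)
  where
    open Construction S E GE α Eα F F⊂⊤ β Δβ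
    open RelativeTo α
    open Within E Eα
    open Above
    open Stage
    st = proj₁ final
    J-empty = proj₂ final
    1≤r = r-positive st J-empty F-nonempty
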